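{- Let $F$ be a maximum matching in a graph $G$ and $K=E(G)\setminus F$. Consider all decompositions of $V(G)$ into disjoint sets $Q,R,S$ such that: (1) $F[Q]$ is a perfect matching of $Q$; (2) $R=\bigcup_{i\in I}V(H_i)$, where each $H_i$ is a hypomatchable connected component of $G-S$, and $F[V(H_i)]$ covers all of $V(H_i)$ except one vertex $r_i$; (3) $S\subseteq\bigcup F$ and for every $s\in S$ the $F$-partner of $s$ is $r_i$ for some $i\in I$. If $(Q,R,S)$ is such a decomposition with $Q$ maximal under containment among all such decompositions, then $$ER(K,F)=\bigcup_{i\in I}V(H_i)\quad\text{and}\quad OR(K,F)=S\cup\bigcup_{i\in I}\bigl(V(H_i)\setminus\{r_i\}\bigr).$$ In particular $S\subseteq OR(K,F)$.
   Context: A graph is hypomatchable if deleting any single vertex leaves a graph with a perfect matching. For a set of edges $F$ and a vertex set $X$, $F[X]=\{f\in F: f\subseteq X\}$; $\bigcup F$ is the set of vertices covered by $F$. Paths are simple. A path is $K$-$F$-alternating if its odd-numbered edges belong to $K$ and its even-numbered edges belong to $F$. A vertex $v$ is oddly (resp. evenly) $K$-reachable from $a$ if there is a $K$-$F$-alternating path starting at $a$ with an edge $ab\in K$ and ending at $v$ having an odd (resp. even) number of edges; for even reachability the path of length zero is allowed. $OR(K,F)$ (resp. $ER(K,F)$) is the set of vertices oddly (resp. evenly) $K$-reachable from some vertex not covered by $F$. -}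

module Defs where

open import Data.Bool using (Bool; true; false; _∧_; not; if_then_else_)
open import Data.Nat using (ℕ; zero; suc; _+_; _*_; _≤_; _<ᵇ_)
open import Data.Fin using (Fin; toℕ)
open import Data.Fin.Subset using (Subset; _∈_; _∉_)
open import Data.List using (List; []; _∷_; length; map; allFin)
open import Data.Nat.ListAction using (sum)
open import Data.List.Relation.Unary.Unique.Propositional using (Unique)
open import Data.Product using (Σ; ∃; ∃-syntax; _×_; _,_)
open import Data.Sum using (_⊎_)
open import Relation.Binary.PropositionalEquality using (_≡_; _≢_)
open import Relation.Binary.Construct.Closure.ReflexiveTransitive using (Star)

record Graph (n : ℕ) : Set where
  field
    adj   : Fin n → Fin n → Bool
    sym   : ∀ u v → adj u v ≡ adj v u
    irref : ∀ v → adj v v ≡ false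
open Graph public

record IsMatching {n : ℕ} (G : Graph n) (F : Fin n → Fin n → Bool) : Set where
  field
    sub    : ∀ u v → F u v ≡ true → adj G u v ≡ true
    fsym   : ∀ u v → F u v ≡ F v u
    unique : ∀ u v w → F u v ≡ true → F u w ≡ true → v ≡ w
open IsMatching public

edgeCount : {n : ℕ} → (Fin n → Fin n → Bool) → ℕ
edgeCount {n} F =
  sum (map (λ i → sum (map (λ j → if (toℕ i <ᵇ toℕ j) ∧ F i j then 1 else 0)
                           (allFin n)))
           (allFin n))

record IsMaximumMatching {n : ℕ} (G : Graph n) (F : Fin n → Fin n → Bool) : Set where
  field
    matching : IsMatching G F
    maximum  : ∀ F′ → IsMatching G F′ → edgeCount F′ ≤ edgeCount F
open IsMaximumMatching public

Covered : {n : ℕ} → (Fin n → Fin n → Bool) → Fin n → Set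
Covered F v = ∃[ u ] F v u ≡ true

record IsPerfectMatchingOf {n : ℕ} (G : Graph n) (X : Fin n → Set)
                           (M : Fin n → Fin n → Bool) : Set where
  field
    pm-matching : IsMatching G M
    pm-inside   : ∀ u v → M u v ≡ true → X u × X v
    pm-covers   : ∀ v → X v → Covered M v
open IsPerfectMatchingOf public

Hypomatchable : {n : ℕ} → Graph n → Subset n → Set
Hypomatchable G H =
  ∀ x → x ∈ H → ∃[ M ] IsPerfectMatchingOf G (λ v → v ∈ H × v ≢ x) M

record IsComponentOf {n : ℕ} (G : Graph n) (S H : Subset n) : Set where
  field
    nonempty  : ∃[ v ] v ∈ H
    avoids    : ∀ v → v ∈ H → v ∉ S
    connected : ∀ u v → u ∈ H → v ∈ H →
                Star (λ a b → a ∈ H × b ∈ H × adj G a b ≡ true) u v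
    closed    : ∀ u v → u ∈ H → v ∉ S → adj G u v ≡ true → v ∈ H
open IsComponentOf public

record Decomposition {n : ℕ} (G : Graph n) (F : Fin n → Fin n → Bool) : Set where
  field
    Q R S     : Subset n
    cover     : ∀ v → v ∈ Q ⊎ v ∈ R ⊎ v ∈ S
    disjQR    : ∀ v → v ∈ Q → v ∉ R
    disjQS    : ∀ v → v ∈ Q → v ∉ S
    disjRS    : ∀ v → v ∈ R → v ∉ S
    perfectQ  : ∀ v → v ∈ Q → ∃[ u ] u ∈ Q × F v u ≡ true
    m         : ℕ
    H         : Fin m → Subset n
    r         : Fin m → Fin n
    component : ∀ i → IsComponentOf G S (H i)
    hypo      : ∀ i → Hypomatchable G (H i)
    R-union   : ∀ v → (v ∈ R → ∃[ i ] v ∈ H i) × (∀ i → v ∈ H i → v ∈ R)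
    r∈H       : ∀ i → r i ∈ H i
    coversH   : ∀ i v → v ∈ H i → v ≢ r i → ∃[ u ] u ∈ H i × F v u ≡ true
    r-uncov   : ∀ i u → u ∈ H i → F (r i) u ≡ false
    S-covered : ∀ s → s ∈ S → Covered F s
    S-partner : ∀ s → s ∈ S → ∃[ i ] F s (r i) ≡ true
open Decomposition public

QMaximal : {n : ℕ} {G : Graph n} {F : Fin n → Fin n → Bool} →
           Decomposition G F → Set
QMaximal {n} {G} {F} D =
  ∀ (D′ : Decomposition G F) →
    (∀ v → v ∈ Q D → v ∈ Q D′) → (∀ v → v ∈ Q D′ → v ∈ Q D)

-- K-F-alternating paths.  Edge b u v: if b, uv ∈ K = E(G) ∖ F, else uv ∈ F.

AltEdge : {n : ℕ} → Graph n → (Fin n → Fin n → Bool) → Bool → Fin n → Fin n → Set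
AltEdge G F true  u v = adj G u v ≡ true × F u v ≡ false
AltEdge G F false u v = F u v ≡ true

-- AltWalk G F b a vs v : the walk a, vs (ending at v) whose first edge is
-- of kind b and whose edges alternate in kind.
data AltWalk {n : ℕ} (G : Graph n) (F : Fin n → Fin n → Bool) :
             Bool → Fin n → List (Fin n) → Fin n → Set where
  stop : ∀ {b v} → AltWalk G F b v [] v
  step : ∀ {b u w vs v} → AltEdge G F b u w → AltWalk G F (not b) w vs v →
         AltWalk G F b u (w ∷ vs) v

-- A K-F-alternating path from a to v: vertices a ∷ vs, all distinct,
-- odd-numbered edges in K, even-numbered in F; it has length vs edges.
AltPath : {n : ℕ} → Graph n → (Fin n → Fin n → Bool) →
          Fin n → List (Fin n) → Fin n → Set
AltPath G F a vs v = AltWalk G F true a vs v × Unique (a ∷ vs)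

OR : {n : ℕ} → Graph n → (Fin n → Fin n → Bool) → Fin n → Set
OR G F v = ∃[ a ] ((∀ u → F a u ≡ false) × ∃[ vs ] AltPath G F a vs v ×
                                   ∃[ k ] length vs ≡ suc (2 * k))

ER : {n : ℕ} → Graph n → (Fin n → Fin n → Bool) → Fin n → Set
ER G F v = ∃[ a ] ((∀ u → F a u ≡ false) × ∃[ vs ] AltPath G F a vs v ×
                                   ∃[ k ] length vs ≡ 2 * k)

module Submission where

-- Write "reach path" for a K-F-alternating path from an F-uncovered vertex;
-- its end is evenly/oddly reached according to the parity of its length.
--  * Soundness.  Following a reach path edge by edge, every vertex reached
--    evenly lies in some H_i whose root r_i is the vertex itself or was
--    passed earlier, and every vertex reached oddly lies in S or in some H_i
--    whose root was passed earlier.  Hence ER ⊆ ⋃ H_i and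
--    OR ⊆ S ∪ ⋃ (H_i - r_i); roots are only ever reached evenly.
--  * Growth.  If r_i is evenly reachable, a perfect matching N of H_i - x
--    (hypomatchability) lets us prolong the path inside H_i by alternating
--    N- and F-edges until it ends at x; so all of H_i is evenly reachable.
--    An evenly reached F-covered vertex is entered by its matching edge, so
--    its partner is oddly reached: this covers H_i - r_i and S.
--  * Maximality.  If some root were not evenly reachable, moving the
--    components with unreachable roots, together with their S-partners,
--    into Q gives a decomposition with larger Q.  So every root is evenly
--    reachable, and the growth step yields the reverse inclusions.
-- The matching is only used as a matching.

open import Defs hiding (sym)
open import Data.Bool using (Bool; true; false; not)
import Data.Bool as Bool
open import Data.Bool.Properties using (not-involutive; ¬-not)
open import Data.Nat using (ℕ; zero; suc; _+_; _*_; _≤_; _<_; z≤n; s≤s)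
open import Data.Nat.Properties
  using (_≤?_; ≰⇒>; <⇒≤; <⇒≱; <-trans; ≤-trans; m<m+n; m≤n+m; +-suc; +-identityʳ;
         +-monoˡ-≤; *-suc; even≢odd)
open import Data.Fin using (Fin; zero; suc)
open import Data.Fin.Properties using (_≟_; any?; all?; pigeonhole; <⇒≢)
open import Data.Fin.Subset using (Subset; _∈_; _∉_)
open import Data.Fin.Subset.Properties using (_∈?_)
open import Data.List using (List; []; _∷_; length; _++_; lookup)
open import Data.List.Properties using (length-++)
open import Data.List.Membership.Propositional using () renaming (_∈_ to _∈ₗ_; _∉_ to _∉ₗ_)
open import Data.List.Membership.Propositional.Properties using (∈-++⁻; ∈-++⁺ˡ; ∈-++⁺ʳ; ∈-lookup)
open import Data.List.Relation.Unary.Any using (here; there)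
import Data.List.Relation.Unary.All as All
open import Data.List.Relation.Unary.All using ([])
import Data.List.Relation.Unary.All.Properties as All
open import Data.List.Relation.Unary.AllPairs using ([]; _∷_)
open import Data.List.Relation.Unary.Unique.Propositional using (Unique)
import Data.List.Relation.Unary.Unique.Propositional.Properties as Unique
open import Data.List.Relation.Binary.Disjoint.Propositional using (Disjoint)
open import Data.Product using (Σ; ∃₂; ∃-syntax; _×_; _,_; proj₁; proj₂)
open import Data.Sum using (_⊎_; inj₁; inj₂; [_,_]′)
open import Data.Empty using (⊥-elim)
open import Data.Vec using (tabulate)
open import Data.Vec.Properties using (lookup∘tabulate; lookup⇒[]=; []=⇒lookup)
open import Function using (_∘_; id; const)
open import Function.Bundles using (_⇔_; mk⇔; Equivalence)
import Function.Properties.Equivalence as ⇔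
open import Relation.Nullary using (¬_; Dec; yes; no; does)
open import Relation.Nullary.Decidable using (_×-dec_; _⊎-dec_; ¬?; dec-true; map′)
open import Relation.Binary.PropositionalEquality
  using (_≡_; _≢_; refl; sym; trans; cong; subst)
open import Relation.Binary.Construct.Closure.ReflexiveTransitive using (Star; ε; _◅_)

true≢false : true ≢ false
true≢false ()

module _ {A : Set} where

  -- The kind of edge following a walk whose first edge has kind b and whose
  -- vertices after the start are vs; kinds alternate along the walk.
  nextKind : Bool → List A → Bool
  nextKind b []       = b
  nextKind b (_ ∷ vs) = nextKind (not b) vs

  nextKind-++ : ∀ b (vs ws : List A) →
                nextKind b (vs ++ ws) ≡ nextKind (nextKind b vs) ws
  nextKind-++ b []       ws = refl
  nextKind-++ b (_ ∷ vs) ws = nextKind-++ (not b) vs ws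

  EvenLength OddLength : List A → Set
  EvenLength vs = ∃[ k ] length vs ≡ 2 * k
  OddLength  vs = ∃[ k ] length vs ≡ suc (2 * k)

  kindParity : ∀ b (vs : List A) → (nextKind b vs ≡ b × EvenLength vs)
                                  ⊎ (nextKind b vs ≡ not b × OddLength vs)
  kindParity b []       = inj₁ (refl , 0 , refl)
  kindParity b (_ ∷ vs) with kindParity (not b) vs
  ... | inj₁ (kind , k , len) = inj₂ (kind , k , cong suc len)
  ... | inj₂ (kind , k , len) =
    inj₁ (trans kind (not-involutive b) , suc k , trans (cong suc len) (sym (*-suc 2 k)))

  even⇔nextKind : (vs : List A) → nextKind true vs ≡ true ⇔ EvenLength vs
  even⇔nextKind vs with kindParity true vs
  ... | inj₁ (kind , even)    = mk⇔ (const even) (const kind)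
  ... | inj₂ (kind , j , odd) =
    mk⇔ (λ kind′ → ⊥-elim (true≢false (trans (sym kind′) kind)))
        (λ { (k , even) → ⊥-elim (even≢odd k j (trans (sym even) odd)) })

  odd⇔nextKind : (vs : List A) → nextKind true vs ≡ false ⇔ OddLength vs
  odd⇔nextKind vs with kindParity true vs
  ... | inj₂ (kind , odd)      = mk⇔ (const odd) (const kind)
  ... | inj₁ (kind , j , even) =
    mk⇔ (λ kind′ → ⊥-elim (true≢false (trans (sym kind) kind′)))
        (λ { (k , odd) → ⊥-elim (even≢odd j k (trans (sym even) odd)) })

module _ {A : Set} where

  Unique-++⁻ˡ : ∀ (xs : List A) {ys} → Unique (xs ++ ys) → Unique xs
  Unique-++⁻ˡ []       _          = []
  Unique-++⁻ˡ (_ ∷ xs) (x∉ ∷ xs!) = All.++⁻ˡ xs x∉ ∷ Unique-++⁻ˡ xs xs!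

  Unique-++⇒disjoint : ∀ (xs : List A) {ys x} → Unique (xs ++ ys) → x ∈ₗ xs → x ∉ₗ ys
  Unique-++⇒disjoint (_ ∷ xs) (x∉ ∷ _)  (here refl) x∈ys = All.lookup (All.++⁻ʳ xs x∉) x∈ys refl
  Unique-++⇒disjoint (_ ∷ xs) (_ ∷ xs!) (there x∈xs)    = Unique-++⇒disjoint xs xs! x∈xs

  Unique-snoc : ∀ {xs : List A} {y} → Unique xs → y ∉ₗ xs → Unique (xs ++ y ∷ [])
  Unique-snoc xs! y∉ = Unique.++⁺ xs! ([] ∷ []) (λ { (y∈ , here refl) → y∉ y∈ })

  Unique-lookup-injective : ∀ {xs : List A} → Unique xs →
                            ∀ {i j} → lookup xs i ≡ lookup xs j → i ≡ j
  Unique-lookup-injective (_  ∷ _)   {zero}  {zero}  _  = refl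
  Unique-lookup-injective (x∉ ∷ _)   {zero}  {suc j} eq = ⊥-elim (All.lookup x∉ (∈-lookup j) eq)
  Unique-lookup-injective (x∉ ∷ _)   {suc i} {zero}  eq = ⊥-elim (All.lookup x∉ (∈-lookup i) (sym eq))
  Unique-lookup-injective (_  ∷ xs!) {suc i} {suc j} eq = cong suc (Unique-lookup-injective xs! eq)

  snoc-longer : ∀ (xs : List A) y → length xs < length (xs ++ y ∷ [])
  snoc-longer xs y = subst (length xs <_) (sym (length-++ xs)) (m<m+n (length xs) (s≤s z≤n))

∈-snoc² : ∀ {A : Set} (xs : List A) {x y z} → x ∈ₗ (xs ++ y ∷ []) ++ z ∷ [] →
          x ∈ₗ xs ⊎ x ≡ y ⊎ x ≡ z
∈-snoc² xs {y = y} x∈ with ∈-++⁻ (xs ++ y ∷ []) x∈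
... | inj₂ (here x≡z) = inj₂ (inj₂ x≡z)
... | inj₁ x∈′ with ∈-++⁻ xs x∈′
...   | inj₁ x∈xs       = inj₁ x∈xs
...   | inj₂ (here x≡y) = inj₂ (inj₁ x≡y)

uniqueLength : ∀ {n} {xs : List (Fin n)} → Unique xs → length xs ≤ n
uniqueLength {n} {xs} xs! with length xs ≤? n
... | yes short = short
... | no  long  with pigeonhole (≰⇒> long) (lookup xs)
...   | i , j , i<j , same = ⊥-elim (<⇒≢ i<j (Unique-lookup-injective xs! same))

boundedList? : ∀ {n} L {P : List (Fin n) → Set} → (∀ xs → Dec (P xs)) →
               Dec (∃[ xs ] (length xs ≤ L × P xs))
boundedList? zero P? with P? []
... | yes p  = yes ([] , z≤n , p)
... | no ¬p  = no λ { ([] , _ , p) → ¬p p ; (_ ∷ _ , () , _) }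
boundedList? (suc L) {P} P? with P? [] | any? (λ x → boundedList? L (λ xs → P? (x ∷ xs)))
... | yes p  | _                   = yes ([] , z≤n , p)
... | no _   | yes (x , xs , l , p) = yes (x ∷ xs , s≤s l , p)
... | no ¬p  | no ¬q                = no λ { ([] , _ , p)          → ¬p p
                                           ; (x ∷ xs , s≤s l , p) → ¬q (x , xs , l , p) }

module _ {State Goal : Set} (size : State → ℕ) (bound : ℕ)
         (bounded : ∀ s → size s ≤ bound)
         (progress : ∀ s → Goal ⊎ Σ State (λ s′ → size s < size s′)) where

  private
    go : ∀ fuel s → bound ≤ size s + fuel → Goal
    go fuel s enough with progress s
    ... | inj₁ goal = goal
    go zero s enough | inj₂ (s′ , grows) =
      ⊥-elim (<⇒≱ grows (≤-trans (bounded s′) (subst (bound ≤_) (+-identityʳ (size s)) enough)))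
    go (suc fuel) s enough | inj₂ (s′ , grows) =
      go fuel s′ (≤-trans enough (subst (_≤ size s′ + fuel) (sym (+-suc (size s) fuel))
                                        (+-monoˡ-≤ fuel grows)))

  search : State → Goal
  search s = go bound s (m≤n+m bound (size s))

module _ {n} {P : Fin n → Set} (P? : ∀ v → Dec (P v)) where

  ⟦_⟧ : Subset n
  ⟦_⟧ = tabulate (λ v → does (P? v))

  ∈⟦⟧⁺ : ∀ {v} → P v → v ∈ ⟦_⟧
  ∈⟦⟧⁺ {v} p = lookup⇒[]= v _ (trans (lookup∘tabulate _ v) (dec-true (P? v) p))

  ∈⟦⟧⁻ : ∀ {v} → v ∈ ⟦_⟧ → P v
  ∈⟦⟧⁻ {v} v∈ with P? v | trans (sym (lookup∘tabulate (λ w → does (P? w)) v)) ([]=⇒lookup v∈)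
  ... | yes p | _ = p
  ... | no _  | ()

componentsMeet : ∀ {n} {G : Graph n} {S A B : Subset n} →
                 IsComponentOf G S A → IsComponentOf G S B →
                 ∀ {u} → u ∈ A → u ∈ B → ∀ {x} → x ∈ A → x ∈ B
componentsMeet {G = G} {A = A} {B} compA compB {u} u∈A u∈B {x} x∈A =
  along (connected compA u x u∈A x∈A) u∈B
  where
    along : ∀ {a b} → Star
              (λ a b → a ∈ A × b ∈ A × adj G a b ≡ true) a b → a ∈ B → b ∈ B
    along ε                      a∈B = a∈B
    along ((_ , c∈A , a~c) ◅ cs) a∈B =
      along cs (closed compB _ _ a∈B (avoids compA _ c∈A) a~c)

module Walks {n : ℕ} (G : Graph n) (F : Fin n → Fin n → Bool) where

  _++ʷ_ : ∀ {b a vs v ws w} → AltWalk G F b a vs v → AltWalk G F (nextKind b vs) v ws w →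
          AltWalk G F b a (vs ++ ws) w
  stop     ++ʷ q = q
  step e p ++ʷ q = step e (p ++ʷ q)

  end∈ : ∀ {b a vs v} → AltWalk G F b a vs v → v ∈ₗ a ∷ vs
  end∈ stop       = here refl
  end∈ (step _ p) = there (end∈ p)

  splitWalk : ∀ {b a vs v y} → AltWalk G F b a vs v → y ∈ₗ a ∷ vs →
              ∃₂ λ vs₁ vs₂ → vs ≡ vs₁ ++ vs₂ × AltWalk G F b a vs₁ y
                                            × AltWalk G F (nextKind b vs₁) y vs₂ v
  splitWalk {vs = vs} p (here refl) = [] , vs , refl , stop , p
  splitWalk stop (there ())
  splitWalk (step {w = w} e p) (there y∈) with splitWalk p y∈
  ... | vs₁ , vs₂ , refl , p₁ , p₂ = w ∷ vs₁ , vs₂ , refl , step e p₁ , p₂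

  lastEdge : ∀ {b a w ws v} → AltWalk G F b a (w ∷ ws) v →
             ∃₂ λ vs p → w ∷ ws ≡ vs ++ v ∷ [] × AltWalk G F b a vs p
                                               × AltEdge G F (nextKind b vs) p v
  lastEdge {a = a} (step e stop) = [] , a , refl , stop , e
  lastEdge (step {w = w} e (step e′ p)) with lastEdge (step e′ p)
  ... | vs , q , eq , p₁ , e₁ = w ∷ vs , q , cong (w ∷_) eq , step e p₁ , e₁

  altEdge? : ∀ b u w → Dec (AltEdge G F b u w)
  altEdge? true  u w = (adj G u w Bool.≟ true) ×-dec (F u w Bool.≟ false)
  altEdge? false u w = F u w Bool.≟ true

  altWalk? : ∀ b a vs v → Dec (AltWalk G F b a vs v)
  altWalk? b a [] v with a ≟ v
  ... | yes refl = yes stop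
  ... | no a≢v   = no λ { stop → a≢v refl }
  altWalk? b a (w ∷ vs) v with altEdge? b a w | altWalk? (not b) w vs v
  ... | yes e  | yes p = yes (step e p)
  ... | no ¬e  | _     = no λ { (step e _) → ¬e e }
  ... | yes _  | no ¬p = no λ { (step _ p) → ¬p p }

module Theory {n : ℕ} (G : Graph n) (F : Fin n → Fin n → Bool)
              (isMatching : IsMatching G F) (D : Decomposition G F) where

  open Walks G F
  open import Data.List.Relation.Unary.Unique.DecPropositional (_≟_ {n}) using (unique?)
  open import Data.List.Membership.DecPropositional (_≟_ {n}) using () renaming (_∈?_ to _∈ₗ?_)

  partner-unique : ∀ {u v w} → F u v ≡ true → F u w ≡ true → v ≡ w
  partner-unique = unique isMatching _ _ _

  F-sym : ∀ {u v} → F u v ≡ true → F v u ≡ true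
  F-sym {u} {v} uv = trans (fsym isMatching v u) uv

  F⇒adj : ∀ {u v} → F u v ≡ true → adj G u v ≡ true
  F⇒adj = sub isMatching _ _

  noLoop : ∀ {u v} → adj G u v ≡ true → u ≢ v
  noLoop {u} u~u refl = true≢false (trans (sym u~u) (irref G u))

  -- Components sharing a vertex have the same root: otherwise r_i would have
  -- an F-partner in H_j, hence in H_i, yet r_i is unmatched inside H_i.
  sameRoot : ∀ {i j u} → u ∈ H D i → u ∈ H D j → r D i ≡ r D j
  sameRoot {i} {j} u∈i u∈j with r D i ≟ r D j
  ... | yes same = same
  ... | no differ with coversH D j (r D i) ri∈j differ
    where ri∈j : r D i ∈ H D j
          ri∈j = componentsMeet (component D i) (component D j) u∈i u∈j (r∈H D i)
  ... | t , t∈j , ri-t = ⊥-elim (true≢false (trans (sym ri-t) (r-uncov D i t t∈i)))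
    where t∈i : t ∈ H D i
          t∈i = closed (component D i) _ _ (r∈H D i) (avoids (component D j) _ t∈j) (F⇒adj ri-t)

  uncoveredIsRoot : ∀ {a} → (∀ u → F a u ≡ false) → ∃[ j ] (a ∈ H D j × r D j ≡ a)
  uncoveredIsRoot {a} free with cover D a
  ... | inj₁ a∈Q with perfectQ D a a∈Q
  ...   | u , _ , a-u = ⊥-elim (true≢false (trans (sym a-u) (free u)))
  uncoveredIsRoot {a} free | inj₂ (inj₂ a∈S) with S-covered D a a∈S
  ...   | u , a-u = ⊥-elim (true≢false (trans (sym a-u) (free u)))
  uncoveredIsRoot {a} free | inj₂ (inj₁ a∈R) with proj₁ (R-union D a) a∈R
  ...   | j , a∈j with a ≟ r D j
  ...     | yes a≡r = j , a∈j , sym a≡r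
  ...     | no  a≢r with coversH D j a a∈j a≢r
  ...       | u , _ , a-u = ⊥-elim (true≢false (trans (sym a-u) (free u)))

  -- A reach path: a K-F-alternating path from an F-uncovered vertex to v,
  -- whose next edge would have kind b (b = true iff its length is even).
  record Reach (b : Bool) (v : Fin n) : Set where
    constructor reach
    field
      start      : Fin n
      start-free : ∀ u → F start u ≡ false
      steps      : List (Fin n)
      walk       : AltWalk G F true start steps v
      distinct   : Unique (start ∷ steps)
      parity     : nextKind true steps ≡ b

    vertices : List (Fin n)
    vertices = start ∷ steps

  ER⇔Reach : ∀ v → ER G F v ⇔ Reach true v
  ER⇔Reach v = mk⇔
    (λ { (a , free , vs , (w , vs!) , even) →
           reach a free vs w vs! (Equivalence.from (even⇔nextKind vs) even) })
    (λ { (reach a free vs w vs! par) → a , free , vs , (w , vs!) , Equivalence.to (even⇔nextKind vs) par })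

  OR⇔Reach : ∀ v → OR G F v ⇔ Reach false v
  OR⇔Reach v = mk⇔
    (λ { (a , free , vs , (w , vs!) , odd) →
           reach a free vs w vs! (Equivalence.from (odd⇔nextKind vs) odd) })
    (λ { (reach a free vs w vs! par) → a , free , vs , (w , vs!) , Equivalence.to (odd⇔nextKind vs) par })

  -- Reach paths have fewer than n steps, so reachability is decidable.
  Reach? : ∀ b v → Dec (Reach b v)
  Reach? b v = map′
    (λ { (a , free , vs , _ , w , vs! , par) → reach a free vs w vs! par })
    (λ { (reach a free vs w vs! par) → a , free , vs , <⇒≤ (uniqueLength vs!) , w , vs! , par })
    (any? λ a → all? (λ u → F a u Bool.≟ false) ×-dec
                boundedList? n (λ vs → altWalk? true a vs v ×-dec unique? (a ∷ vs)
                                                            ×-dec (nextKind true vs Bool.≟ b)))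

  extend : ∀ {b u w} (P : Reach b u) → AltEdge G F b u w → w ∉ₗ Reach.vertices P → Reach (not b) w
  extend {b} {u} {w} P e w∉ = record
    { start      = start
    ; start-free = start-free
    ; steps      = steps ++ w ∷ []
    ; walk       = walk ++ʷ subst (λ c → AltWalk G F c u (w ∷ []) w) (sym parity) (step e stop)
    ; distinct   = Unique-snoc distinct w∉
    ; parity     = trans (nextKind-++ true steps (w ∷ [])) (cong not parity)
    }
    where open Reach P

  record Cut {b v} (P : Reach b v) (x : Fin n) : Set where
    field
      kind      : Bool
      initial   : Reach kind x
      rest      : List (Fin n)
      vertices≡ : Reach.vertices P ≡ Reach.vertices initial ++ rest
      end∈rest  : v ∈ₗ x ∷ rest

  cut : ∀ {b v x} (P : Reach b v) → x ∈ₗ Reach.vertices P → Cut P x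
  cut (reach a free vs w vs! _) x∈ with splitWalk w x∈
  ... | vs₁ , vs₂ , refl , w₁ , w₂ = record
    { kind      = nextKind true vs₁
    ; initial   = reach a free vs₁ w₁ (Unique-++⁻ˡ (a ∷ vs₁) vs!) refl
    ; rest      = vs₂
    ; vertices≡ = refl
    ; end∈rest  = end∈ w₂
    }

  -- An even reach path ends with a matching edge, so the F-partner of its
  -- end is oddly reachable.
  partnerOdd : ∀ {u w} → Reach true w → F u w ≡ true → Reach false u
  partnerOdd {u} (reach a free [] stop _ _) u-a = ⊥-elim (true≢false (trans (sym (F-sym u-a)) (free u)))
  partnerOdd {u} {w} (reach a free (x ∷ xs) walk vs! par) u-w with lastEdge walk
  ... | vs , p , split , walk₁ , last with matchingEdge (nextKind true vs) last endsEven
    where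
      endsEven : not (nextKind true vs) ≡ true
      endsEven = trans (sym (nextKind-++ true vs (w ∷ [])))
                       (subst (λ ys → nextKind true ys ≡ true) split par)
      matchingEdge : ∀ κ → AltEdge G F κ p w → not κ ≡ true → κ ≡ false × F p w ≡ true
      matchingEdge false p-w _ = refl , p-w
      matchingEdge true  _   ()
  ... | odd , p-w =
    reach a free vs (subst (AltWalk G F true a vs) p≡u walk₁)
          (Unique-++⁻ˡ (a ∷ vs) (subst (λ ys → Unique (a ∷ ys)) split vs!)) odd
    where p≡u : p ≡ u
          p≡u = partner-unique (F-sym p-w) (F-sym u-w)

  -- Where a vertex u can sit on a reach path, given the list `seen` of
  -- vertices passed before it and the kind b of the edge leaving u.
  Placed : Bool → Fin n → List (Fin n) → Set
  Placed true  u seen = ∃[ i ] (u ∈ H D i × (r D i ≡ u ⊎ r D i ∈ₗ seen))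
  Placed false u seen = u ∈ S D ⊎ ∃[ i ] (u ∈ H D i × r D i ∈ₗ seen)

  -- A K-edge leaves H_i only into S (H_i is a component of G - S); an F-edge
  -- from S leads to a root, and from H_i - r_i stays inside H_i.
  placedStep : ∀ {b u w seen} → Placed b u seen → u ∉ₗ seen → AltEdge G F b u w →
               Placed (not b) w (u ∷ seen)
  placedStep {true} {u} {w} (i , u∈H , root) _ (u~w , _) with w ∈? S D
  ... | yes w∈S = inj₁ w∈S
  ... | no  w∉S = inj₂ (i , closed (component D i) u w u∈H w∉S u~w , [ here , there ]′ root)
  placedStep {false} {u} {w} (inj₁ u∈S) _ u-w with S-partner D u u∈S
  ... | i , u-r = i , subst (_∈ H D i) (sym w≡r) (r∈H D i) , inj₁ (sym w≡r)
    where w≡r : w ≡ r D i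
          w≡r = partner-unique u-w u-r
  placedStep {false} {u} {w} (inj₂ (i , u∈H , r∈seen)) u∉seen u-w
    with coversH D i u u∈H (λ u≡r → u∉seen (subst (_∈ₗ _) (sym u≡r) r∈seen))
  ... | t , t∈H , u-t = i , subst (_∈ H D i) (partner-unique u-t u-w) t∈H , inj₂ (there r∈seen)

  placedAlong : ∀ {b u vs v} seen → AltWalk G F b u vs v → Unique (u ∷ vs) →
                Disjoint seen (u ∷ vs) → Placed b u seen →
                ∃[ seen′ ] (Placed (nextKind b vs) v seen′ × v ∉ₗ seen′
                           × (∀ {x} → x ∈ₗ seen′ → x ∈ₗ seen ⊎ x ∈ₗ u ∷ vs))
  placedAlong seen stop _ apart placed = seen , placed , (λ v∈ → apart (v∈ , here refl)) , inj₁
  placedAlong {u = u} seen (step {w = w} {vs = vs} e p) (u∉ ∷ vs!) apart placed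
    with placedAlong (u ∷ seen) p vs! apart′ (placedStep placed (λ u∈ → apart (u∈ , here refl)) e)
    where
      apart′ : Disjoint (u ∷ seen) (w ∷ vs)
      apart′ (here refl , u∈)  = All.lookup u∉ u∈ refl
      apart′ (there x∈ , x∈′) = apart (x∈ , there x∈′)
  ... | seen′ , placed′ , v∉ , earlier = seen′ , placed′ , v∉ , regroup ∘ earlier
    where
      regroup : ∀ {x} → x ∈ₗ u ∷ seen ⊎ x ∈ₗ w ∷ vs → x ∈ₗ seen ⊎ x ∈ₗ u ∷ w ∷ vs
      regroup (inj₁ (here x≡u))  = inj₂ (here x≡u)
      regroup (inj₁ (there x∈)) = inj₁ x∈
      regroup (inj₂ x∈)         = inj₂ (there x∈)

  endPlaced : ∀ {b v} (P : Reach b v) →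
              ∃[ seen ] (Placed b v seen × v ∉ₗ seen × (∀ {x} → x ∈ₗ seen → x ∈ₗ Reach.vertices P))
  endPlaced (reach a free vs w vs! par) with uncoveredIsRoot free
  ... | j , a∈H , r≡a with placedAlong [] w vs! (λ { (() , _) }) (j , a∈H , inj₁ r≡a)
  ...   | seen , placed , v∉ , earlier =
    seen , subst (λ c → Placed c _ seen) par placed , v∉ , [ (λ ()) , id ]′ ∘ earlier

  evenEnd : ∀ {v} → Reach true v → ∃[ i ] v ∈ H D i
  evenEnd P with endPlaced P
  ... | _ , (i , v∈H , _) , _ = i , v∈H

  oddEnd : ∀ {v} → Reach false v → v ∈ S D ⊎ ∃[ i ] (v ∈ H D i × v ≢ r D i)
  oddEnd P with endPlaced P
  ... | _ , inj₁ v∈S , _                 = inj₁ v∈S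
  ... | _ , inj₂ (i , v∈H , r∈seen) , v∉ , _ =
    inj₂ (i , v∈H , λ v≡r → v∉ (subst (_∈ₗ _) (sym v≡r) r∈seen))

  rootBefore : ∀ {b x j} (P : Reach b x) → x ∈ H D j → x ≢ r D j → r D j ∈ₗ Reach.vertices P
  rootBefore {true} {j = j} P x∈j x≢r with endPlaced P
  ... | _ , (i , x∈i , inj₁ r≡x)    , _ = ⊥-elim (x≢r (trans (sym r≡x) (sameRoot x∈i x∈j)))
  ... | _ , (i , x∈i , inj₂ r∈seen) , _ , earlier =
    earlier (subst (_∈ₗ _) (sameRoot x∈i x∈j) r∈seen)
  rootBefore {false} {j = j} P x∈j x≢r with endPlaced P
  ... | _ , inj₁ x∈S , _ = ⊥-elim (avoids (component D j) _ x∈j x∈S)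
  ... | _ , inj₂ (i , x∈i , r∈seen) , _ , earlier =
    earlier (subst (_∈ₗ _) (sameRoot x∈i x∈j) r∈seen)

  rootEven : ∀ {b i} → Reach b (r D i) → b ≡ true
  rootEven {true}  _ = refl
  rootEven {false} {i} P with oddEnd P
  ... | inj₁ r∈S              = ⊥-elim (avoids (component D i) _ (r∈H D i) r∈S)
  ... | inj₂ (j , r∈j , r≢r) = ⊥-elim (r≢r (sameRoot (r∈H D i) r∈j))

  sOdd : ∀ {b s} → Reach b s → s ∈ S D → b ≡ false
  sOdd {false} _ _ = refl
  sOdd {true}  P s∈S with evenEnd P
  ... | i , s∈H = ⊥-elim (avoids (component D i) _ s∈H s∈S)

  rootOnPath : ∀ {b v k} (P : Reach b v) → r D k ∈ₗ Reach.vertices P → Reach true (r D k)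
  rootOnPath P r∈ = subst (λ c → Reach c _) (rootEven initial) initial
    where open Cut (cut P r∈)

  -- An even reach path to r_i meets H_i only in r_i: any other vertex of H_i
  -- on it would be preceded by r_i, which then occurred twice.
  meetsOwnComponentAtRoot : ∀ {i x} (P : Reach true (r D i)) → x ∈ₗ Reach.vertices P →
                            x ∈ H D i → x ≡ r D i
  meetsOwnComponentAtRoot {i} {x} P x∈ x∈H with x ≟ r D i
  ... | yes x≡r = x≡r
  ... | no  x≢r = ⊥-elim (Unique-++⇒disjoint (Reach.vertices initial)
                           (subst Unique vertices≡ (Reach.distinct P))
                           (rootBefore initial x∈H x≢r) r∈rest)
    where
      open Cut (cut P x∈)
      r∈rest : r D i ∈ₗ rest
      r∈rest with end∈rest
      ... | here r≡x  = ⊥-elim (x≢r (sym r≡x))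
      ... | there r∈ = r∈

  partnerRootEven : ∀ {s k} → Reach false s → F s (r D k) ≡ true → Reach true (r D k)
  partnerRootEven {k = k} P s-r with r D k ∈ₗ? Reach.vertices P
  ... | yes r∈ = rootOnPath P r∈
  ... | no  r∉ = extend P s-r r∉

  -- Growing a reach path inside H_i towards a vertex e, guided by a perfect
  -- matching N of H_i - e: alternately follow N (a K-edge) and F.
  module Growth {i : Fin (m D)} {e : Fin n} {N : Fin n → Fin n → Bool}
                (N-perfect : IsPerfectMatchingOf G (λ v → v ∈ H D i × v ≢ e) N) where

    N-sym : ∀ {u v} → N u v ≡ true → N v u ≡ true
    N-sym {u} {v} uv = trans (fsym (pm-matching N-perfect) v u) uv

    N-partner-unique : ∀ {u v w} → N u v ≡ true → N u w ≡ true → v ≡ w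
    N-partner-unique = unique (pm-matching N-perfect) _ _ _

    N⇒adj : ∀ {u v} → N u v ≡ true → adj G u v ≡ true
    N⇒adj = sub (pm-matching N-perfect) _ _

    record Frontier : Set where
      field
        cur      : Fin n
        path     : Reach true cur
        cur∈H    : cur ∈ H D i
        root∈    : r D i ∈ₗ Reach.vertices path
        N-closed : ∀ {u t} → u ∈ₗ Reach.vertices path → N u t ≡ true →
                   u ≡ cur ⊎ (t ∈ₗ Reach.vertices path × t ≢ cur)
        F-closed : ∀ {u t} → u ∈ₗ Reach.vertices path → u ∈ H D i → u ≢ r D i →
                   F u t ≡ true → t ∈ₗ Reach.vertices path

    size : Frontier → ℕ
    size s = length (Reach.vertices (Frontier.path s))

    -- Any even reach path to r_i is a frontier, since it meets H_i only in r_i.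
    initialFrontier : Reach true (r D i) → Frontier
    initialFrontier P = record
      { cur      = r D i
      ; path     = P
      ; cur∈H    = r∈H D i
      ; root∈    = end∈ (Reach.walk P)
      ; N-closed = λ u∈ u-t →
                     inj₁ (meetsOwnComponentAtRoot P u∈ (proj₁ (proj₁ (pm-inside N-perfect _ _ u-t))))
      ; F-closed = λ u∈ u∈H u≢r _ → ⊥-elim (u≢r (meetsOwnComponentAtRoot P u∈ u∈H))
      }

    record Round (s : Frontier) : Set where
      field
        y z      : Fin n
        cur-y    : N (Frontier.cur s) y ≡ true
        cur-y∉F  : F (Frontier.cur s) y ≡ false
        y∉       : y ∉ₗ Reach.vertices (Frontier.path s)
        y-z      : F y z ≡ true
        z∈H      : z ∈ H D i
        z∉       : z ∉ₗ Reach.vertices (Frontier.path s) ++ y ∷ []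

    nextRound : (s : Frontier) → Frontier.cur s ≢ e → Round s
    nextRound s cur≢e = record
      { y = y ; z = z ; cur-y = cur-y ; cur-y∉F = cur-y∉F ; y∉ = y∉ ; y-z = y-z ; z∈H = z∈H ; z∉ = z∉ }
      where
        open Frontier s
        V : List (Fin n)
        V = Reach.vertices path
        y : Fin n
        y = proj₁ (pm-covers N-perfect cur (cur∈H , cur≢e))
        cur-y : N cur y ≡ true
        cur-y = proj₂ (pm-covers N-perfect cur (cur∈H , cur≢e))
        y∈H : y ∈ H D i
        y∈H = proj₁ (proj₂ (pm-inside N-perfect _ _ cur-y))
        y∉ : y ∉ₗ V
        y∉ y∈ with N-closed y∈ (N-sym cur-y)
        ... | inj₁ y≡cur         = noLoop (N⇒adj cur-y) (sym y≡cur)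
        ... | inj₂ (_ , cur≢cur) = cur≢cur refl
        -- r_i is unmatched inside H_i; other path vertices of H_i have their
        -- partners on the path.
        cur-y∉F : F cur y ≡ false
        cur-y∉F with F cur y in cur-y∈F | cur ≟ r D i
        ... | false | _         = refl
        ... | true  | yes cur≡r = ⊥-elim (true≢false (trans (sym cur-y∈F)
                                   (subst (λ c → F c y ≡ false) (sym cur≡r) (r-uncov D i y y∈H))))
        ... | true  | no  cur≢r = ⊥-elim (y∉ (F-closed (end∈ (Reach.walk path)) cur∈H cur≢r cur-y∈F))
        y≢r : y ≢ r D i
        y≢r y≡r = y∉ (subst (_∈ₗ V) (sym y≡r) root∈)
        z : Fin n
        z = proj₁ (coversH D i y y∈H y≢r)
        z∈H : z ∈ H D i
        z∈H = proj₁ (proj₂ (coversH D i y y∈H y≢r))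
        y-z : F y z ≡ true
        y-z = proj₂ (proj₂ (coversH D i y y∈H y≢r))
        z∉ : z ∉ₗ V ++ y ∷ []
        z∉ z∈ with ∈-++⁻ V z∈
        ... | inj₂ (here z≡y) = noLoop (F⇒adj y-z) (sym z≡y)
        ... | inj₁ z∈V        = y∉ (F-closed z∈V z∈H z≢r (F-sym y-z))
          where
            z≢r : z ≢ r D i
            z≢r z≡r = true≢false (trans (sym (F-sym y-z))
                                        (subst (λ c → F c y ≡ false) (sym z≡r) (r-uncov D i y y∈H)))

    advance : (s : Frontier) → Frontier.cur s ≢ e → Σ Frontier (λ s′ → size s < size s′)
    advance s cur≢e = record
      { cur = z ; path = P″ ; cur∈H = z∈H ; root∈ = old root∈
      ; N-closed = N-closed′ ; F-closed = F-closed′ }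
      , <-trans (snoc-longer V y) (snoc-longer (V ++ y ∷ []) z)
      where
        open Frontier s
        open Round (nextRound s cur≢e)
        V V″ : List (Fin n)
        V  = Reach.vertices path
        V″ = (V ++ y ∷ []) ++ z ∷ []
        P″ : Reach true z
        P″ = extend (extend path (N⇒adj cur-y , cur-y∉F) y∉) y-z z∉
        old : ∀ {x} → x ∈ₗ V → x ∈ₗ V″
        old = ∈-++⁺ˡ ∘ ∈-++⁺ˡ
        y∈V″ : y ∈ₗ V″
        y∈V″ = ∈-++⁺ˡ (∈-++⁺ʳ V (here refl))
        z∈V″ : z ∈ₗ V″
        z∈V″ = ∈-++⁺ʳ (V ++ y ∷ []) (here refl)
        z∉V : ∀ {x} → x ∈ₗ V → x ≢ z
        z∉V x∈ refl = z∉ (∈-++⁺ˡ x∈)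
        N-closed′ : ∀ {u t} → u ∈ₗ V″ → N u t ≡ true → u ≡ z ⊎ (t ∈ₗ V″ × t ≢ z)
        N-closed′ u∈ u-t with ∈-snoc² V u∈
        ... | inj₂ (inj₂ u≡z) = inj₁ u≡z
        ... | inj₂ (inj₁ refl) with N-partner-unique u-t (N-sym cur-y)
        ...   | refl = inj₂ (old (end∈ (Reach.walk path)) , z∉V (end∈ (Reach.walk path)))
        N-closed′ u∈ u-t | inj₁ u∈V with N-closed u∈V u-t
        ...   | inj₁ refl with N-partner-unique u-t cur-y
        ...     | refl = inj₂ (y∈V″ , λ y≡z → z∉ (∈-++⁺ʳ V (here (sym y≡z))))
        N-closed′ u∈ u-t | inj₁ u∈V | inj₂ (t∈V , _) = inj₂ (old t∈V , z∉V t∈V)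
        F-closed′ : ∀ {u t} → u ∈ₗ V″ → u ∈ H D i → u ≢ r D i → F u t ≡ true → t ∈ₗ V″
        F-closed′ u∈ u∈H u≢r u-t with ∈-snoc² V u∈
        ... | inj₁ u∈V         = old (F-closed u∈V u∈H u≢r u-t)
        ... | inj₂ (inj₁ refl) = subst (_∈ₗ V″) (partner-unique y-z u-t) z∈V″
        ... | inj₂ (inj₂ refl) = subst (_∈ₗ V″) (partner-unique (F-sym y-z) u-t) y∈V″

    reachTarget : Reach true (r D i) → Reach true e
    reachTarget P = search size n (λ s → uniqueLength (Reach.distinct (Frontier.path s))) progress
                           (initialFrontier P)
      where
        progress : ∀ s → Reach true e ⊎ Σ Frontier (λ s′ → size s < size s′)
        progress s with Frontier.cur s ≟ e
        ... | yes cur≡e = inj₁ (subst (Reach true) cur≡e (Frontier.path s))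
        ... | no  cur≢e = inj₂ (advance s cur≢e)

  evenInComponent : ∀ {i x} → Reach true (r D i) → x ∈ H D i → Reach true x
  evenInComponent {i} {x} P x∈H with hypo D i x x∈H
  ... | _ , N-perfect = Growth.reachTarget N-perfect P

  oddInComponent : ∀ {i x} → Reach true (r D i) → x ∈ H D i → x ≢ r D i → Reach false x
  oddInComponent {i} {x} P x∈H x≢r with coversH D i x x∈H x≢r
  ... | t , t∈H , x-t = partnerOdd (evenInComponent P t∈H) x-t

  exitToS : ∀ {j k u s} → Reach true (r D j) → u ∈ H D j → s ∈ S D → adj G u s ≡ true →
            F s (r D k) ≡ true → Reach true (r D k)
  exitToS {k = k} {u} {s} P u∈H s∈S u~s s-r = viaPath (evenInComponent P u∈H)
    where
      viaPath : Reach true u → Reach true (r D k)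
      -- s is either on the path (then oddly reached), or the matching partner
      -- of u (then u = r_k), or reached from u along the K-edge u s.
      viaPath Pu with s ∈ₗ? Reach.vertices Pu | F u s in u-s
      ... | yes s∈ | _     = partnerRootEven (subst (λ c → Reach c s) (sOdd initial s∈S) initial) s-r
        where open Cut (cut Pu s∈)
      ... | no  s∉ | true  = subst (Reach true) (partner-unique (F-sym u-s) s-r) Pu
      ... | no  s∉ | false = partnerRootEven (extend Pu (u~s , u-s) s∉) s-r

  Good : Fin (m D) → Set
  Good i = Reach true (r D i)

  good? : ∀ i → Dec (Good i)
  good? i = Reach? true (r D i)

  -- The vertices a larger Q could absorb: the components whose root is not
  -- evenly reachable, together with the S-vertices matched to those roots.
  Stuck : Fin n → Set
  Stuck v = (∃[ i ] (v ∈ H D i × ¬ Good i))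
          ⊎ (v ∈ S D × ∃[ i ] (F v (r D i) ≡ true × ¬ Good i))

  stuck? : ∀ v → Dec (Stuck v)
  stuck? v = any? (λ i → (v ∈? H D i) ×-dec ¬? (good? i))
             ⊎-dec ((v ∈? S D) ×-dec any? (λ i → (F v (r D i) Bool.≟ true) ×-dec ¬? (good? i)))

  record GoodListing : Set where
    field
      count      : ℕ
      index      : Fin count → Fin (m D)
      index-good : ∀ j → Good (index j)
      index-onto : ∀ i → Good i → ∃[ j ] index j ≡ i

  goodListing : GoodListing
  goodListing with any? good?
  ... | no none = record
    { count = 0 ; index = λ () ; index-good = λ () ; index-onto = λ i g → ⊥-elim (none (i , g)) }
  ... | yes (i₀ , g₀) = record
    { count      = m D
    ; index      = λ i → pick i (good? i)
    ; index-good = λ i → pick-good i (good? i)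
    ; index-onto = λ i g → i , pick-fixes i (good? i) g
    }
    where
      pick : ∀ i → Dec (Good i) → Fin (m D)
      pick i (yes _) = i
      pick i (no _)  = i₀
      pick-good : ∀ i g? → Good (pick i g?)
      pick-good i (yes g) = g
      pick-good i (no _)  = g₀
      pick-fixes : ∀ i g? → Good i → pick i g? ≡ i
      pick-fixes i (yes _)  _ = refl
      pick-fixes i (no ¬g) g = ⊥-elim (¬g g)

  module Enlarge (L : GoodListing) where
    open GoodListing L

    InQ′ InR′ InS′ : Fin n → Set
    InQ′ v = v ∈ Q D ⊎ Stuck v
    InR′ v = v ∈ R D × ¬ Stuck v
    InS′ v = v ∈ S D × ¬ Stuck v

    inQ′? : ∀ v → Dec (InQ′ v)
    inQ′? v = (v ∈? Q D) ⊎-dec stuck? v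
    inR′? : ∀ v → Dec (InR′ v)
    inR′? v = (v ∈? R D) ×-dec ¬? (stuck? v)
    inS′? : ∀ v → Dec (InS′ v)
    inS′? v = (v ∈? S D) ×-dec ¬? (stuck? v)

    -- A root that is not evenly reachable is matched, necessarily into S.
    stuckRootPartner : ∀ i → ¬ Good i → ∃[ u ] (u ∈ ⟦ inQ′? ⟧ × F (r D i) u ≡ true)
    stuckRootPartner i bad with any? (λ u → F (r D i) u Bool.≟ true)
    ... | no unmatched = ⊥-elim (bad (reach (r D i) (λ u → ¬-not (λ r-u → unmatched (u , r-u)))
                                              [] stop ([] ∷ []) refl))
    ... | yes (u , r-u) with u ∈? S D
    ...   | yes u∈S = u , ∈⟦⟧⁺ inQ′? (inj₂ (inj₂ (u∈S , i , F-sym r-u , bad))) , r-u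
    ...   | no  u∉S = ⊥-elim (true≢false (trans (sym r-u) (r-uncov D i u
                        (closed (component D i) _ _ (r∈H D i) u∉S (F⇒adj r-u)))))

    partnerInQ′ : ∀ v → v ∈ ⟦ inQ′? ⟧ → ∃[ u ] (u ∈ ⟦ inQ′? ⟧ × F v u ≡ true)
    partnerInQ′ v v∈ with ∈⟦⟧⁻ inQ′? v∈
    ... | inj₁ v∈Q with perfectQ D v v∈Q
    ...   | u , u∈Q , v-u = u , ∈⟦⟧⁺ inQ′? (inj₁ u∈Q) , v-u
    partnerInQ′ v v∈ | inj₂ (inj₂ (v∈S , i , v-r , bad)) =
      r D i , ∈⟦⟧⁺ inQ′? (inj₂ (inj₁ (i , r∈H D i , bad))) , v-r
    partnerInQ′ v v∈ | inj₂ (inj₁ (i , v∈H , bad)) with v ≟ r D i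
    ...   | yes refl = stuckRootPartner i bad
    ...   | no  v≢r with coversH D i v v∈H v≢r
    ...     | u , u∈H , v-u = u , ∈⟦⟧⁺ inQ′? (inj₂ (inj₁ (i , u∈H , bad))) , v-u

    -- A good component is still a component of G - S′: the S-vertices it
    -- touches are matched to good roots (exitToS), so they stay in S′.
    goodComponent : ∀ j → IsComponentOf G ⟦ inS′? ⟧ (H D (index j))
    goodComponent j = record
      { nonempty  = nonempty C
      ; avoids    = λ v v∈H v∈S′ → avoids C v v∈H (proj₁ (∈⟦⟧⁻ inS′? v∈S′))
      ; connected = connected C
      ; closed    = stillClosed
      }
      where
        C : IsComponentOf G (S D) (H D (index j))
        C = component D (index j)
        stillClosed : ∀ u v → u ∈ H D (index j) → v ∉ ⟦ inS′? ⟧ → adj G u v ≡ true →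
                      v ∈ H D (index j)
        stillClosed u v u∈H v∉S′ u~v with v ∈? S D
        ... | no  v∉S = closed C u v u∈H v∉S u~v
        ... | yes v∈S with stuck? v
        ...   | no  free                        = ⊥-elim (v∉S′ (∈⟦⟧⁺ inS′? (v∈S , free)))
        ...   | yes (inj₁ (k , v∈k , _))        = ⊥-elim (avoids (component D k) v v∈k v∈S)
        ...   | yes (inj₂ (_ , k , v-r , bad)) = ⊥-elim (bad (exitToS (index-good j) u∈H v∈S u~v v-r))

    R′-union : ∀ v → (v ∈ ⟦ inR′? ⟧ → ∃[ j ] v ∈ H D (index j))
                   × (∀ j → v ∈ H D (index j) → v ∈ ⟦ inR′? ⟧)
    R′-union v = listed , (λ j v∈H → ∈⟦⟧⁺ inR′? (proj₂ (R-union D v) (index j) v∈H , notStuck j v∈H))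
      where
        listed : v ∈ ⟦ inR′? ⟧ → ∃[ j ] v ∈ H D (index j)
        listed v∈ with ∈⟦⟧⁻ inR′? v∈
        ... | v∈R , free with proj₁ (R-union D v) v∈R
        ...   | i , v∈H with good? i
        ...     | no  bad = ⊥-elim (free (inj₁ (i , v∈H , bad)))
        ...     | yes g with index-onto i g
        ...       | j , refl = j , v∈H
        notStuck : ∀ j → v ∈ H D (index j) → ¬ Stuck v
        notStuck j v∈H (inj₁ (k , v∈k , bad)) = bad (subst (Reach true) (sameRoot v∈H v∈k) (index-good j))
        notStuck j v∈H (inj₂ (v∈S , _))      = avoids (component D (index j)) v v∈H v∈S

    S′-partner : ∀ s → s ∈ ⟦ inS′? ⟧ → ∃[ j ] F s (r D (index j)) ≡ true
    S′-partner s s∈ with ∈⟦⟧⁻ inS′? s∈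
    ... | s∈S , free with S-partner D s s∈S
    ...   | i , s-r with good? i
    ...     | no  bad = ⊥-elim (free (inj₂ (s∈S , i , s-r , bad)))
    ...     | yes g with index-onto i g
    ...       | j , refl = j , s-r

    D′ : Decomposition G F
    D′ = record
      { Q = ⟦ inQ′? ⟧ ; R = ⟦ inR′? ⟧ ; S = ⟦ inS′? ⟧
      ; cover     = cover′
      ; disjQR    = disjQR′
      ; disjQS    = disjQS′
      ; disjRS    = λ v v∈R′ v∈S′ → disjRS D v (proj₁ (∈⟦⟧⁻ inR′? v∈R′)) (proj₁ (∈⟦⟧⁻ inS′? v∈S′))
      ; perfectQ  = partnerInQ′
      ; m         = count
      ; H         = H D ∘ index
      ; r         = r D ∘ index
      ; component = goodComponent
      ; hypo      = hypo D ∘ index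
      ; R-union   = R′-union
      ; r∈H       = r∈H D ∘ index
      ; coversH   = coversH D ∘ index
      ; r-uncov   = r-uncov D ∘ index
      ; S-covered = λ s s∈ → S-covered D s (proj₁ (∈⟦⟧⁻ inS′? s∈))
      ; S-partner = S′-partner
      }
      where
        disjQR′ : ∀ v → v ∈ ⟦ inQ′? ⟧ → v ∉ ⟦ inR′? ⟧
        disjQR′ v v∈Q′ v∈R′ with ∈⟦⟧⁻ inQ′? v∈Q′ | ∈⟦⟧⁻ inR′? v∈R′
        ... | inj₁ v∈Q   | v∈R , _    = disjQR D v v∈Q v∈R
        ... | inj₂ stuck | _ , ¬stuck = ¬stuck stuck
        disjQS′ : ∀ v → v ∈ ⟦ inQ′? ⟧ → v ∉ ⟦ inS′? ⟧
        disjQS′ v v∈Q′ v∈S′ with ∈⟦⟧⁻ inQ′? v∈Q′ | ∈⟦⟧⁻ inS′? v∈S′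
        ... | inj₁ v∈Q   | v∈S , _    = disjQS D v v∈Q v∈S
        ... | inj₂ stuck | _ , ¬stuck = ¬stuck stuck
        cover′ : ∀ v → v ∈ ⟦ inQ′? ⟧ ⊎ v ∈ ⟦ inR′? ⟧ ⊎ v ∈ ⟦ inS′? ⟧
        cover′ v with stuck? v
        ... | yes st = inj₁ (∈⟦⟧⁺ inQ′? (inj₂ st))
        ... | no  free with cover D v
        ...   | inj₁ v∈Q          = inj₁ (∈⟦⟧⁺ inQ′? (inj₁ v∈Q))
        ...   | inj₂ (inj₁ v∈R)  = inj₂ (inj₁ (∈⟦⟧⁺ inR′? (v∈R , free)))
        ...   | inj₂ (inj₂ v∈S)  = inj₂ (inj₂ (∈⟦⟧⁺ inS′? (v∈S , free)))

  -- In a Q-maximal decomposition every root is evenly reachable: otherwise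
  -- the enlarged decomposition would put the root into Q.
  everyRootGood : QMaximal D → ∀ i → Good i
  everyRootGood maximal i with good? i
  ... | yes g   = g
  ... | no  bad = ⊥-elim (disjQR D (r D i) r∈Q (proj₂ (R-union D (r D i)) i (r∈H D i)))
    where
      open Enlarge goodListing
      r∈Q : r D i ∈ Q D
      r∈Q = maximal D′ (λ v v∈Q → ∈⟦⟧⁺ inQ′? (inj₁ v∈Q)) (r D i)
                       (∈⟦⟧⁺ inQ′? (inj₂ (inj₁ (i , r∈H D i , bad))))

  module Characterisation (good : ∀ i → Good i) where

    evenReach⇔ : ∀ v → Reach true v ⇔ (∃[ i ] v ∈ H D i)
    evenReach⇔ v = mk⇔ evenEnd (λ { (i , v∈H) → evenInComponent (good i) v∈H })

    oddInS : ∀ {s} → s ∈ S D → Reach false s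
    oddInS {s} s∈S with S-partner D s s∈S
    ... | i , s-r = partnerOdd (good i) s-r

    oddReach⇔ : ∀ v → Reach false v ⇔ (v ∈ S D ⊎ ∃[ i ] (v ∈ H D i × v ≢ r D i))
    oddReach⇔ v = mk⇔ oddEnd
      λ { (inj₁ v∈S)              → oddInS v∈S
        ; (inj₂ (i , v∈H , v≢r)) → oddInComponent (good i) v∈H v≢r }

lemma3p7 : ∀ {n : ℕ} (G : Graph n) (F : Fin n → Fin n → Bool) →
    IsMaximumMatching G F →
    (D : Decomposition G F) → QMaximal D →
    (∀ v → ER G F v ⇔ (∃[ i ] v ∈ H D i))
    × (∀ v → OR G F v ⇔ (v ∈ S D ⊎ ∃[ i ] (v ∈ H D i × v ≢ r D i)))
    × (∀ v → v ∈ S D → OR G F v)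
lemma3p7 G F maximum D maximal =
    (λ v → ⇔.trans (ER⇔Reach v) (evenReach⇔ v))
  , (λ v → ⇔.trans (OR⇔Reach v) (oddReach⇔ v))
  , (λ s s∈S → Equivalence.from (OR⇔Reach s) (oddInS s∈S))
  where
    open Theory G F (matching maximum) D
    open Characterisation (everyRootGood maximal)
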